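{- For every integer $n\ge 1$, the number of $2_0$-Dyck paths of length $3n$ having exactly one down-step at a height of $1$ modulo $2$ and $n-1$ down-steps at a height of $2$ modulo $2$ equals the total number of valleys over all Dyck paths of length $2n$.
   Context: For non-negative integers $k,t,n$ with $0\le t<k$, a $k_t$-Dyck path of length $(k+1)n$ is a lattice path consisting of $n$ down-steps $(1,-k)$ and $kn$ up-steps $(1,1)$ that starts at $(0,0)$, ends at $((k+1)n,0)$, and stays weakly above the line $y=-t$. A down-step is at a height of $i$ modulo $k$ if its endpoint's $y$-coordinate is congruent to $i$ modulo $k$. A Dyck path of length $2n$ is a path of $n$ steps $(1,1)$ and $n$ steps $(1,-1)$ from $(0,0)$ to $(2n,0)$ staying weakly above the $x$-axis; a valley is a down-step immediately followed by an up-step. -}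

module Defs where

open import Data.Nat using (ℕ; zero; suc; _+_; _*_; _≡ᵇ_; NonZero)
open import Data.Integer as ℤ using (ℤ; +_; -_; _≤ᵇ_)
open import Data.Integer.Base using (_%ℕ_)
open import Data.Bool using (Bool; true; false; _∧_; if_then_else_)
open import Data.List using (List; []; _∷_; length; filterᵇ; map; concatMap)
open import Data.Nat.ListAction using (sum)

-- A step of a lattice path: up-step (1,1) or down-step (1,-k).
data Step : Set where
  U D : Step

allPaths : ℕ → List (List Step)
allPaths zero    = [] ∷ []
allPaths (suc m) = concatMap (λ p → (U ∷ p) ∷ (D ∷ p) ∷ []) (allPaths m)

countD : List Step → ℕ
countD []      = 0
countD (U ∷ p) = countD p
countD (D ∷ p) = suc (countD p)

countU : List Step → ℕ
countU []      = 0
countU (U ∷ p) = suc (countU p)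
countU (D ∷ p) = countU p

stepH : ℕ → Step → ℤ → ℤ
stepH k U h = h ℤ.+ + 1
stepH k D h = h ℤ.- + k

staysEnds : ℕ → ℕ → ℤ → List Step → Bool
staysEnds k t h []      = (h ℤ.≤ᵇ + 0) ∧ (+ 0 ℤ.≤ᵇ h)
staysEnds k t h (s ∷ p) =
  let h' = stepH k s h in ((- (+ t)) ℤ.≤ᵇ h') ∧ staysEnds k t h' p

-- p is a k_t-Dyck path of length (k+1)n:
-- n down-steps, kn up-steps, from (0,0) to ((k+1)n,0), weakly above y = -t.
isDyckKT : ℕ → ℕ → ℕ → List Step → Bool
isDyckKT k t n p =
  (countD p ≡ᵇ n) ∧ (countU p ≡ᵇ k * n) ∧ staysEnds k t (+ 0) p

-- Number of down-steps whose endpoint's y-coordinate is ≡ i (mod k),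
-- for a path (with down-steps (1,-k)) starting at height h.
downsAtMod : (k : ℕ) → .{{NonZero k}} → ℕ → ℤ → List Step → ℕ
downsAtMod k i h []      = 0
downsAtMod k i h (U ∷ p) = downsAtMod k i (stepH k U h) p
downsAtMod k i h (D ∷ p) =
  (if ((stepH k D h) %ℕ k) ≡ᵇ ((+ i) %ℕ k) then 1 else 0)
    + downsAtMod k i (stepH k D h) p

countDyckKT-12 : (k : ℕ) → .{{NonZero k}} → ℕ → ℕ → ℕ → ℕ → ℕ
countDyckKT-12 k t n a₁ a₂ = length (filterᵇ
  (λ p → isDyckKT k t n p ∧ (downsAtMod k 1 (+ 0) p ≡ᵇ a₁)
                          ∧ (downsAtMod k 2 (+ 0) p ≡ᵇ a₂))
  (allPaths ((k + 1) * n)))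

isDyck : ℕ → List Step → Bool
isDyck n p = isDyckKT 1 0 n p

valleys : List Step → ℕ
valleys []            = 0
valleys (D ∷ U ∷ p)   = suc (valleys (U ∷ p))
valleys (_ ∷ p)       = valleys p

totalValleys : ℕ → ℕ
totalValleys n = sum (map valleys (filterᵇ (isDyck n) (allPaths (2 * n))))

-- A 2_0-path starting at an even height whose down-steps all end at even heights
-- takes its up-steps in pairs between down-steps, so halving all heights turns it
-- into a Dyck path. A path with exactly one down-step ending at an odd height has
-- that step preceded and followed by an odd run of up-steps; contracting the
-- factor U D U around it to D U and halving gives a Dyck path with a marked valley.
-- Rather than building these bijections, the proof counts both sides by their
-- first-step recurrences in the state (height, down-steps left, up-steps left) and
-- checks that the recurrences agree under this halving.

module Submission where

open import Defs
open import Data.Bool using (Bool; true; false; _∧_; if_then_else_; T)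
open import Data.Bool.Properties using (∧-zeroʳ; T-∧; if-∧; if-eta; if-cong; if-cong-then)
open import Data.Integer as ℤ using (ℤ; +_; _⊖_)
open import Data.Integer.Base using (_%ℕ_)
open import Data.Integer.DivMod using (n%ℕd<d)
open import Data.Integer.Properties using (m-n≡m⊖n; ⊖-≥; [1+m]⊖[1+n]≡m⊖n)
open import Data.List using (List; []; _∷_; length; filterᵇ; map; concatMap)
open import Data.List.Properties using (map-cong)
open import Data.Nat
  using (ℕ; NonZero; zero; suc; pred; _+_; _*_; _∸_; _%_; _≤_; _<_; _≥_; _≤ᵇ_; _<ᵇ_; _≡ᵇ_; s≤s)
open import Data.Nat.ListAction using (sum)
open import Data.Nat.Properties
  using (+-assoc; +-comm; +-suc; +-identityʳ; *-identityˡ; suc-injective; ≰⇒>;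
         ≡ᵇ⇒≡; ≡⇒≡ᵇ; ≤ᵇ-reflects-≤; +-commutativeSemigroup)
open import Algebra.Properties.CommutativeSemigroup +-commutativeSemigroup using (interchange)
open import Data.Empty using (⊥-elim)
open import Data.Product using (proj₁)
open import Data.Unit using (tt)
open import Function.Bundles using (Equivalence)
open import Relation.Nullary.Reflects using (ofʸ; ofⁿ)
open import Relation.Binary.PropositionalEquality
open ≡-Reasoning

Σpaths : ℕ → (List Step → ℕ) → ℕ
Σpaths m w = sum (map w (allPaths m))

sum-map-+ : ∀ {A : Set} (f g : A → ℕ) xs →
  sum (map (λ x → f x + g x) xs) ≡ sum (map f xs) + sum (map g xs)
sum-map-+ f g []       = refl
sum-map-+ f g (x ∷ xs) =
  trans (cong (λ s → f x + g x + s) (sum-map-+ f g xs)) (interchange (f x) (g x) _ _)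

Σpaths-suc : ∀ m w →
  Σpaths (suc m) w ≡ Σpaths m (λ p → w (U ∷ p)) + Σpaths m (λ p → w (D ∷ p))
Σpaths-suc m w = trans (byFirstStep (allPaths m)) (sum-map-+ _ _ (allPaths m))
  where
  byFirstStep : ∀ ps → sum (map w (concatMap (λ p → (U ∷ p) ∷ (D ∷ p) ∷ []) ps))
                     ≡ sum (map (λ p → w (U ∷ p) + w (D ∷ p)) ps)
  byFirstStep []       = refl
  byFirstStep (p ∷ ps) = trans (sym (+-assoc (w (U ∷ p)) _ _))
                               (cong (λ s → w (U ∷ p) + w (D ∷ p) + s) (byFirstStep ps))

Σpaths-cong : ∀ m {w w′ : List Step → ℕ} → (∀ p → w p ≡ w′ p) → Σpaths m w ≡ Σpaths m w′
Σpaths-cong m w≗w′ = cong sum (map-cong w≗w′ (allPaths m))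

Σpaths-+ : ∀ m (f g : List Step → ℕ) → Σpaths m (λ p → f p + g p) ≡ Σpaths m f + Σpaths m g
Σpaths-+ m f g = sum-map-+ f g (allPaths m)

Σpaths-zero : ∀ m → Σpaths m (λ _ → 0) ≡ 0
Σpaths-zero m = go (allPaths m)
  where
  go : ∀ (ps : List (List Step)) → sum (map (λ _ → 0) ps) ≡ 0
  go []       = refl
  go (_ ∷ ps) = go ps

length-filterᵇ : ∀ {A : Set} (P : A → Bool) xs →
  length (filterᵇ P xs) ≡ sum (map (λ x → if P x then 1 else 0) xs)
length-filterᵇ P []       = refl
length-filterᵇ P (x ∷ xs) with P x
... | true  = cong suc (length-filterᵇ P xs)
... | false = length-filterᵇ P xs

sum-map-filterᵇ : ∀ {A : Set} (P : A → Bool) (f : A → ℕ) xs →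
  sum (map f (filterᵇ P xs)) ≡ sum (map (λ x → if P x then f x else 0) xs)
sum-map-filterᵇ P f []       = refl
sum-map-filterᵇ P f (x ∷ xs) with P x
... | true  = cong (λ s → f x + s) (sum-map-filterᵇ P f xs)
... | false = sum-map-filterᵇ P f xs

-- A state (h, d, u) consists of the current height h and the numbers d of
-- down-steps and u of up-steps still to be taken; paths stay weakly above 0.
isFinal : ℕ → ℕ → ℕ → Bool
isFinal h d u = (h ≡ᵇ 0) ∧ (d + u ≡ᵇ 0)

isPathFrom : (k h d u : ℕ) → List Step → Bool
isPathFrom k h d u []      = isFinal h d u
isPathFrom k h d u (U ∷ p) = (0 <ᵇ u) ∧ isPathFrom k (suc h) d (pred u) p
isPathFrom k h d u (D ∷ p) = (0 <ᵇ d) ∧ (k ≤ᵇ h) ∧ isPathFrom k (h ∸ k) (pred d) u p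

stepH-D-≥ : ∀ k h → k ≤ h → stepH k D (+ h) ≡ + (h ∸ k)
stepH-D-≥ k h k≤h = trans (m-n≡m⊖n h k) (⊖-≥ k≤h)

0≤ᵇ⊖-< : ∀ m n → m < n → (+ 0 ℤ.≤ᵇ m ⊖ n) ≡ false
0≤ᵇ⊖-< zero    (suc n) _         = refl
0≤ᵇ⊖-< (suc m) (suc n) (s≤s m<n) =
  trans (cong (+ 0 ℤ.≤ᵇ_) ([1+m]⊖[1+n]≡m⊖n m n)) (0≤ᵇ⊖-< m n m<n)

stepH-D-< : ∀ k h → h < k → (+ 0 ℤ.≤ᵇ stepH k D (+ h)) ≡ false
stepH-D-< k h h<k = trans (cong (+ 0 ℤ.≤ᵇ_) (m-n≡m⊖n h k)) (0≤ᵇ⊖-< h k h<k)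

counts∧staysEnds≡isPathFrom : ∀ k h d u p →
  (countD p ≡ᵇ d) ∧ (countU p ≡ᵇ u) ∧ staysEnds k 0 (+ h) p ≡ isPathFrom k h d u p
counts∧staysEnds≡isPathFrom k zero    zero    zero    []      = refl
counts∧staysEnds≡isPathFrom k zero    zero    (suc u) []      = refl
counts∧staysEnds≡isPathFrom k zero    (suc d) u       []      = refl
counts∧staysEnds≡isPathFrom k (suc h) zero    zero    []      = refl
counts∧staysEnds≡isPathFrom k (suc h) zero    (suc u) []      = refl
counts∧staysEnds≡isPathFrom k (suc h) (suc d) u       []      = refl
counts∧staysEnds≡isPathFrom k h d zero    (U ∷ p) = ∧-zeroʳ (countD p ≡ᵇ d)
counts∧staysEnds≡isPathFrom k h d (suc u) (U ∷ p)
  rewrite +-comm h 1 = counts∧staysEnds≡isPathFrom k (suc h) d u p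
counts∧staysEnds≡isPathFrom k h zero    u (D ∷ p) = refl
counts∧staysEnds≡isPathFrom k h (suc d) u (D ∷ p) with k ≤ᵇ h | ≤ᵇ-reflects-≤ k h
... | true  | ofʸ k≤h rewrite stepH-D-≥ k h k≤h = counts∧staysEnds≡isPathFrom k (h ∸ k) d u p
... | false | ofⁿ k≰h rewrite stepH-D-< k h (≰⇒> k≰h) =
  trans (cong ((countD p ≡ᵇ d) ∧_) (∧-zeroʳ (countU p ≡ᵇ u))) (∧-zeroʳ (countD p ≡ᵇ d))

ΣpathsFrom : (k m h d u : ℕ) → (List Step → ℕ) → ℕ
ΣpathsFrom k m h d u w = Σpaths m (λ p → if isPathFrom k h d u p then w p else 0)

ΣpathsFromᵁ : (k m h d u : ℕ) → (List Step → ℕ) → ℕ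
ΣpathsFromᵁ k m h d zero    w = 0
ΣpathsFromᵁ k m h d (suc u) w = ΣpathsFrom k m (suc h) d u (λ p → w (U ∷ p))

ΣpathsFromᴰ : (k m h d u : ℕ) → (List Step → ℕ) → ℕ
ΣpathsFromᴰ k m h zero    u w = 0
ΣpathsFromᴰ k m h (suc d) u w =
  if k ≤ᵇ h then ΣpathsFrom k m (h ∸ k) d u (λ p → w (D ∷ p)) else 0

ΣpathsFrom-suc : ∀ k m h d u w →
  ΣpathsFrom k (suc m) h d u w ≡ ΣpathsFromᵁ k m h d u w + ΣpathsFromᴰ k m h d u w
ΣpathsFrom-suc k m h d u w = trans (Σpaths-suc m _) (cong₂ _+_ (byUp u) (byDown d))
  where
  byUp : ∀ u → Σpaths m (λ p → if isPathFrom k h d u (U ∷ p) then w (U ∷ p) else 0)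
             ≡ ΣpathsFromᵁ k m h d u w
  byUp zero    = Σpaths-zero m
  byUp (suc u) = refl
  byDown : ∀ d → Σpaths m (λ p → if isPathFrom k h d u (D ∷ p) then w (D ∷ p) else 0)
               ≡ ΣpathsFromᴰ k m h d u w
  byDown zero    = Σpaths-zero m
  byDown (suc d) with k ≤ᵇ h
  ... | true  = refl
  ... | false = Σpaths-zero m

ΣpathsFrom-+ : ∀ k m h d u (f g : List Step → ℕ) →
  ΣpathsFrom k m h d u (λ p → f p + g p) ≡ ΣpathsFrom k m h d u f + ΣpathsFrom k m h d u g
ΣpathsFrom-+ k m h d u f g =
  trans (Σpaths-cong m (λ p → if-+ (isPathFrom k h d u p))) (Σpaths-+ m _ _)
  where
  if-+ : ∀ {x y} b → (if b then x + y else 0) ≡ (if b then x else 0) + (if b then y else 0)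
  if-+ true  = refl
  if-+ false = refl

ΣpathsFrom-zero : ∀ k m h d u → ΣpathsFrom k m h d u (λ _ → 0) ≡ 0
ΣpathsFrom-zero k m h d u =
  trans (Σpaths-cong m (λ p → if-eta (isPathFrom k h d u p))) (Σpaths-zero m)

isFinal-nonempty : ∀ {m} h d u → suc m ≡ d + u → isFinal h d u ≡ false
isFinal-nonempty h d u eq =
  trans (cong (λ n → (h ≡ᵇ 0) ∧ (n ≡ᵇ 0)) (sym eq)) (∧-zeroʳ (h ≡ᵇ 0))

length-afterUp : ∀ {m} d u → suc m ≡ d + suc u → m ≡ d + u
length-afterUp d u eq = suc-injective (trans eq (+-suc d u))

mutual
  pathCount : (k h d u : ℕ) → ℕ
  pathCount k h d u =
    (if isFinal h d u then 1 else 0) + pathCountᵁ k h d u + pathCountᴰ k h d u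

  pathCountᵁ : (k h d u : ℕ) → ℕ
  pathCountᵁ k h d zero    = 0
  pathCountᵁ k h d (suc u) = pathCount k (suc h) d u

  pathCountᴰ : (k h d u : ℕ) → ℕ
  pathCountᴰ k h zero    u = 0
  pathCountᴰ k h (suc d) u = if k ≤ᵇ h then pathCount k (h ∸ k) d u else 0

mutual
  valleyCount : (k h d u : ℕ) → ℕ
  valleyCount k h d u = valleyCountᵁ k h d u + valleyCountᴰ k h d u

  valleyCountᵁ : (k h d u : ℕ) → ℕ
  valleyCountᵁ k h d zero    = 0
  valleyCountᵁ k h d (suc u) = valleyCount k (suc h) d u

  valleyCountᴰ : (k h d u : ℕ) → ℕ
  valleyCountᴰ k h zero    u = 0
  valleyCountᴰ k h (suc d) u =
    if k ≤ᵇ h then pathCountᵁ k (h ∸ k) d u + valleyCount k (h ∸ k) d u else 0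

-- pathCountDownsAt k i a h d u counts the paths from (h, d, u) with exactly a
-- down-steps ending at a height ≡ i (mod k).
mutual
  pathCountDownsAt : (k : ℕ) .{{_ : NonZero k}} (i a h d u : ℕ) → ℕ
  pathCountDownsAt k i a h d u =
    (if (a ≡ᵇ 0) ∧ isFinal h d u then 1 else 0)
      + pathCountDownsAtᵁ k i a h d u + pathCountDownsAtᴰ k i a h d u

  pathCountDownsAtᵁ : (k : ℕ) .{{_ : NonZero k}} (i a h d u : ℕ) → ℕ
  pathCountDownsAtᵁ k i a h d zero    = 0
  pathCountDownsAtᵁ k i a h d (suc u) = pathCountDownsAt k i a (suc h) d u

  pathCountDownsAtᴰ : (k : ℕ) .{{_ : NonZero k}} (i a h d u : ℕ) → ℕ
  pathCountDownsAtᴰ k i a h zero    u = 0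
  pathCountDownsAtᴰ k i a h (suc d) u =
    if k ≤ᵇ h
    then (if (h ∸ k) % k ≡ᵇ i % k
          then (if 0 <ᵇ a then pathCountDownsAt k i (pred a) (h ∸ k) d u else 0)
          else pathCountDownsAt k i a (h ∸ k) d u)
    else 0

ΣpathsFrom-pathCount : ∀ k m h d u → m ≡ d + u →
  ΣpathsFrom k m h d u (λ _ → 1) ≡ pathCount k h d u
ΣpathsFrom-pathCount k zero zero    zero    zero    refl = refl
ΣpathsFrom-pathCount k zero (suc h) zero    zero    refl = refl
ΣpathsFrom-pathCount k (suc m) h d u eq =
  trans (ΣpathsFrom-suc k m h d u _)
  (trans (cong₂ _+_ (byUp u eq) (byDown d eq))
         (cong (λ b → (if b then 1 else 0) + pathCountᵁ k h d u + pathCountᴰ k h d u)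
               (sym (isFinal-nonempty h d u eq))))
  where
  byUp : ∀ u → suc m ≡ d + u → ΣpathsFromᵁ k m h d u (λ _ → 1) ≡ pathCountᵁ k h d u
  byUp zero    _  = refl
  byUp (suc u) eq = ΣpathsFrom-pathCount k m (suc h) d u (length-afterUp d u eq)
  byDown : ∀ d → suc m ≡ d + u → ΣpathsFromᴰ k m h d u (λ _ → 1) ≡ pathCountᴰ k h d u
  byDown zero    _  = refl
  byDown (suc d) eq =
    if-cong-then (k ≤ᵇ h) (ΣpathsFrom-pathCount k m (h ∸ k) d u (suc-injective eq))

startsWithUp : List Step → ℕ
startsWithUp (U ∷ _) = 1
startsWithUp _       = 0

valleys-D∷ : ∀ p → valleys (D ∷ p) ≡ startsWithUp p + valleys p
valleys-D∷ []      = refl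
valleys-D∷ (U ∷ p) = refl
valleys-D∷ (D ∷ p) = refl

ΣpathsFrom-startsWithUp : ∀ k m h d u → m ≡ d + u →
  ΣpathsFrom k m h d u startsWithUp ≡ pathCountᵁ k h d u
ΣpathsFrom-startsWithUp k zero zero    zero    zero    refl = refl
ΣpathsFrom-startsWithUp k zero (suc h) zero    zero    refl = refl
ΣpathsFrom-startsWithUp k (suc m) h d u eq =
  trans (ΣpathsFrom-suc k m h d u startsWithUp)
  (trans (cong₂ _+_ (byUp u eq) (byDown d)) (+-identityʳ (pathCountᵁ k h d u)))
  where
  byUp : ∀ u → suc m ≡ d + u → ΣpathsFromᵁ k m h d u startsWithUp ≡ pathCountᵁ k h d u
  byUp zero    _  = refl
  byUp (suc u) eq = ΣpathsFrom-pathCount k m (suc h) d u (length-afterUp d u eq)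
  byDown : ∀ d → ΣpathsFromᴰ k m h d u startsWithUp ≡ 0
  byDown zero    = refl
  byDown (suc d) =
    trans (if-cong-then (k ≤ᵇ h) (ΣpathsFrom-zero k m (h ∸ k) d u)) (if-eta (k ≤ᵇ h))

ΣpathsFrom-valleys : ∀ k m h d u → m ≡ d + u →
  ΣpathsFrom k m h d u valleys ≡ valleyCount k h d u
ΣpathsFrom-valleys k zero zero    zero    zero    refl = refl
ΣpathsFrom-valleys k zero (suc h) zero    zero    refl = refl
ΣpathsFrom-valleys k (suc m) h d u eq =
  trans (ΣpathsFrom-suc k m h d u valleys) (cong₂ _+_ (byUp u eq) (byDown d eq))
  where
  byUp : ∀ u → suc m ≡ d + u → ΣpathsFromᵁ k m h d u valleys ≡ valleyCountᵁ k h d u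
  byUp zero    _  = refl
  byUp (suc u) eq = ΣpathsFrom-valleys k m (suc h) d u (length-afterUp d u eq)
  byDown : ∀ d → suc m ≡ d + u → ΣpathsFromᴰ k m h d u valleys ≡ valleyCountᴰ k h d u
  byDown zero    _  = refl
  byDown (suc d) eq = if-cong-then (k ≤ᵇ h) (begin
      ΣpathsFrom k m (h ∸ k) d u (λ p → valleys (D ∷ p))
    ≡⟨ Σpaths-cong m (λ p → if-cong-then (isPathFrom k (h ∸ k) d u p) (valleys-D∷ p)) ⟩
      ΣpathsFrom k m (h ∸ k) d u (λ p → startsWithUp p + valleys p)
    ≡⟨ ΣpathsFrom-+ k m (h ∸ k) d u startsWithUp valleys ⟩
      ΣpathsFrom k m (h ∸ k) d u startsWithUp + ΣpathsFrom k m (h ∸ k) d u valleys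
    ≡⟨ cong₂ _+_ (ΣpathsFrom-startsWithUp k m (h ∸ k) d u m≡)
                 (ΣpathsFrom-valleys k m (h ∸ k) d u m≡) ⟩
      pathCountᵁ k (h ∸ k) d u + valleyCount k (h ∸ k) d u
    ∎)
    where
    m≡ : m ≡ d + u
    m≡ = suc-injective eq

ΣpathsFrom-downsAt : ∀ k .{{_ : NonZero k}} i a m h d u → m ≡ d + u →
  ΣpathsFrom k m h d u (λ p → if downsAtMod k i (+ h) p ≡ᵇ a then 1 else 0)
    ≡ pathCountDownsAt k i a h d u
ΣpathsFrom-downsAt k i zero    zero zero    zero zero refl = refl
ΣpathsFrom-downsAt k i zero    zero (suc h) zero zero refl = refl
ΣpathsFrom-downsAt k i (suc a) zero zero    zero zero refl = refl
ΣpathsFrom-downsAt k i (suc a) zero (suc h) zero zero refl = refl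
ΣpathsFrom-downsAt k i a (suc m) h d u eq =
  trans (ΣpathsFrom-suc k m h d u _)
  (trans (cong₂ _+_ (byUp u eq) (byDown a d eq))
         (cong (λ b → (if b then 1 else 0)
                        + pathCountDownsAtᵁ k i a h d u + pathCountDownsAtᴰ k i a h d u)
               (sym (trans (cong ((a ≡ᵇ 0) ∧_) (isFinal-nonempty h d u eq))
                           (∧-zeroʳ (a ≡ᵇ 0))))))
  where
  byUp : ∀ u → suc m ≡ d + u →
    ΣpathsFromᵁ k m h d u (λ p → if downsAtMod k i (+ h) p ≡ᵇ a then 1 else 0)
      ≡ pathCountDownsAtᵁ k i a h d u
  byUp zero    _  = refl
  byUp (suc u) eq rewrite +-comm h 1 =
    ΣpathsFrom-downsAt k i a m (suc h) d u (length-afterUp d u eq)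
  byDown : ∀ a d → suc m ≡ d + u →
    ΣpathsFromᴰ k m h d u (λ p → if downsAtMod k i (+ h) p ≡ᵇ a then 1 else 0)
      ≡ pathCountDownsAtᴰ k i a h d u
  byDown a zero    _  = refl
  byDown a (suc d) eq with k ≤ᵇ h | ≤ᵇ-reflects-≤ k h
  ... | false | ofⁿ _   = refl
  ... | true  | ofʸ k≤h rewrite stepH-D-≥ k h k≤h with (h ∸ k) % k ≡ᵇ i % k
  ...   | false = ΣpathsFrom-downsAt k i a m (h ∸ k) d u (suc-injective eq)
  ...   | true  = landed a
    where
    landed : ∀ a →
      ΣpathsFrom k m (h ∸ k) d u (λ p → if suc (downsAtMod k i (+ (h ∸ k)) p) ≡ᵇ a then 1 else 0)
        ≡ (if 0 <ᵇ a then pathCountDownsAt k i (pred a) (h ∸ k) d u else 0)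
    landed zero    = ΣpathsFrom-zero k m (h ∸ k) d u
    landed (suc a) = ΣpathsFrom-downsAt k i a m (h ∸ k) d u (suc-injective eq)

twice : ℕ → ℕ
twice zero    = zero
twice (suc n) = suc (suc (twice n))

twice-%2 : ∀ n → twice n % 2 ≡ 0
twice-%2 zero    = refl
twice-%2 (suc n) = twice-%2 n

suc-twice-%2 : ∀ n → suc (twice n) % 2 ≡ 1
suc-twice-%2 zero    = refl
suc-twice-%2 (suc n) = suc-twice-%2 n

isFinal-twice : ∀ h d u → isFinal (twice h) d (twice u) ≡ isFinal h d u
isFinal-twice zero    zero    zero    = refl
isFinal-twice zero    zero    (suc u) = refl
isFinal-twice zero    (suc d) u       = refl
isFinal-twice (suc h) d       u       = refl

pathCountDownsAtᴰ-even : ∀ a h d u →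
  pathCountDownsAtᴰ 2 1 a (twice (suc h)) (suc d) u ≡ pathCountDownsAt 2 1 a (twice h) d u
pathCountDownsAtᴰ-even a h d u rewrite twice-%2 h = refl

pathCountDownsAtᴰ-odd : ∀ a h d u →
  pathCountDownsAtᴰ 2 1 a (suc (twice (suc h))) (suc d) u
    ≡ (if 0 <ᵇ a then pathCountDownsAt 2 1 (pred a) (suc (twice h)) d u else 0)
pathCountDownsAtᴰ-odd a h d u rewrite suc-twice-%2 h = refl

noOddDownsᴰ-odd : ∀ h d u → pathCountDownsAtᴰ 2 1 0 (suc (twice h)) d u ≡ 0
noOddDownsᴰ-odd zero    zero    u = refl
noOddDownsᴰ-odd zero    (suc d) u = refl
noOddDownsᴰ-odd (suc h) zero    u = refl
noOddDownsᴰ-odd (suc h) (suc d) u = pathCountDownsAtᴰ-odd 0 h d u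

noOddDowns-odd : ∀ h d u →
  pathCountDownsAt 2 1 0 (suc (twice h)) d (suc u) ≡ pathCountDownsAt 2 1 0 (twice (suc h)) d u
noOddDowns-odd h d u =
  trans (cong (_+_ (pathCountDownsAt 2 1 0 (twice (suc h)) d u)) (noOddDownsᴰ-odd h d (suc u)))
        (+-identityʳ _)

noOddDowns≡pathCount : ∀ h d u →
  pathCountDownsAt 2 1 0 (twice h) d (twice u) ≡ pathCount 1 h d u
noOddDowns≡pathCount h d u =
  cong₂ _+_ (cong₂ _+_ (if-cong (isFinal-twice h d u)) (byUp u)) (byDown h d)
  where
  byUp : ∀ u → pathCountDownsAtᵁ 2 1 0 (twice h) d (twice u) ≡ pathCountᵁ 1 h d u
  byUp zero    = refl
  byUp (suc u) = trans (noOddDowns-odd h d (twice u)) (noOddDowns≡pathCount (suc h) d u)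
  byDown : ∀ h d → pathCountDownsAtᴰ 2 1 0 (twice h) d (twice u) ≡ pathCountᴰ 1 h d u
  byDown zero    zero    = refl
  byDown zero    (suc d) = refl
  byDown (suc h) zero    = refl
  byDown (suc h) (suc d) =
    trans (pathCountDownsAtᴰ-even 0 h d (twice u)) (noOddDowns≡pathCount h d u)

mutual
  oneOddDown≡valleyCount : ∀ h d u →
    pathCountDownsAt 2 1 1 (twice h) d (twice u) ≡ valleyCount 1 h d u
  oneOddDown≡valleyCount h d zero    = oneOddDownᴰ-noUps h d
  oneOddDown≡valleyCount h d (suc u) = begin
      pathCountDownsAt 2 1 1 (twice (suc h)) d (twice u)
        + pathCountDownsAtᴰ 2 1 1 (suc (twice h)) d (suc (twice u))
        + pathCountDownsAtᴰ 2 1 1 (twice h) d (twice (suc u))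
    ≡⟨ +-assoc (pathCountDownsAt 2 1 1 (twice (suc h)) d (twice u)) _ _ ⟩
      pathCountDownsAt 2 1 1 (twice (suc h)) d (twice u)
        + (pathCountDownsAtᴰ 2 1 1 (suc (twice h)) d (suc (twice u))
           + pathCountDownsAtᴰ 2 1 1 (twice h) d (twice (suc u)))
    ≡⟨ cong₂ _+_ (oneOddDown≡valleyCount (suc h) d u) (oneOddDownᴰ h d u) ⟩
      valleyCount 1 (suc h) d u + valleyCountᴰ 1 h d (suc u)
    ∎

  oneOddDownᴰ-noUps : ∀ h d → pathCountDownsAtᴰ 2 1 1 (twice h) d 0 ≡ valleyCountᴰ 1 h d 0
  oneOddDownᴰ-noUps zero    zero    = refl
  oneOddDownᴰ-noUps zero    (suc d) = refl
  oneOddDownᴰ-noUps (suc h) zero    = refl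
  oneOddDownᴰ-noUps (suc h) (suc d) =
    trans (pathCountDownsAtᴰ-even 1 h d 0) (oneOddDown≡valleyCount h d 0)

  oneOddDownᴰ : ∀ h d u →
    pathCountDownsAtᴰ 2 1 1 (suc (twice h)) d (suc (twice u))
      + pathCountDownsAtᴰ 2 1 1 (twice h) d (twice (suc u))
      ≡ valleyCountᴰ 1 h d (suc u)
  oneOddDownᴰ zero    zero    u = refl
  oneOddDownᴰ zero    (suc d) u = refl
  oneOddDownᴰ (suc h) zero    u = refl
  oneOddDownᴰ (suc h) (suc d) u = cong₂ _+_
    (trans (pathCountDownsAtᴰ-odd 1 h d (suc (twice u)))
    (trans (noOddDowns-odd h d (twice u)) (noOddDowns≡pathCount (suc h) d u)))
    (trans (pathCountDownsAtᴰ-even 1 h d (twice (suc u))) (oneOddDown≡valleyCount h d (suc u)))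

downsAtOdd+downsAtEven : ∀ h p → downsAtMod 2 1 h p + downsAtMod 2 2 h p ≡ countD p
downsAtOdd+downsAtEven h []      = refl
downsAtOdd+downsAtEven h (U ∷ p) = downsAtOdd+downsAtEven (stepH 2 U h) p
downsAtOdd+downsAtEven h (D ∷ p) =
  trans (interchange (isOdd h′) (downsAtMod 2 1 h′ p) (isEven h′) (downsAtMod 2 2 h′ p))
        (cong₂ _+_ (oddOrEven (h′ %ℕ 2) (n%ℕd<d h′ 2)) (downsAtOdd+downsAtEven h′ p))
  where
  h′ = stepH 2 D h
  isOdd isEven : ℤ → ℕ
  isOdd  x = if x %ℕ 2 ≡ᵇ 1 then 1 else 0
  isEven x = if x %ℕ 2 ≡ᵇ 0 then 1 else 0
  oddOrEven : ∀ r → r < 2 → (if r ≡ᵇ 1 then 1 else 0) + (if r ≡ᵇ 0 then 1 else 0) ≡ 1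
  oddOrEven zero          _ = refl
  oddOrEven (suc zero)    _ = refl
  oddOrEven (suc (suc r)) (s≤s (s≤s ()))

∧-redundantʳ : ∀ x y {z} → (T x → T y → T z) → x ∧ y ∧ z ≡ x ∧ y
∧-redundantʳ false y         _     = refl
∧-redundantʳ true  false     _     = refl
∧-redundantʳ true  true {true}  _     = refl
∧-redundantʳ true  true {false} x⇒y⇒z = ⊥-elim (x⇒y⇒z tt tt)

oneOddDown-indicator : ∀ n p →
  (if isDyckKT 2 0 n p ∧ (downsAtMod 2 1 (+ 0) p ≡ᵇ 1) ∧ (downsAtMod 2 2 (+ 0) p ≡ᵇ n ∸ 1)
   then 1 else 0)
  ≡ (if isPathFrom 2 0 n (2 * n) p then (if downsAtMod 2 1 (+ 0) p ≡ᵇ 1 then 1 else 0) else 0)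
oneOddDown-indicator n p =
  trans (if-cong (∧-redundantʳ (isDyckKT 2 0 n p) (downsAtMod 2 1 (+ 0) p ≡ᵇ 1) evenDowns))
  (trans (if-∧ (isDyckKT 2 0 n p)) (if-cong (counts∧staysEnds≡isPathFrom 2 0 n (2 * n) p)))
  where
  evenDowns : T (isDyckKT 2 0 n p) → T (downsAtMod 2 1 (+ 0) p ≡ᵇ 1)
            → T (downsAtMod 2 2 (+ 0) p ≡ᵇ n ∸ 1)
  evenDowns isDyck oneOdd = ≡⇒≡ᵇ _ _ (cong (_∸ 1) (begin
      suc (downsAtMod 2 2 (+ 0) p)
    ≡⟨ cong (_+ downsAtMod 2 2 (+ 0) p) (≡ᵇ⇒≡ _ _ oneOdd) ⟨
      downsAtMod 2 1 (+ 0) p + downsAtMod 2 2 (+ 0) p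
    ≡⟨ downsAtOdd+downsAtEven (+ 0) p ⟩
      countD p
    ≡⟨ ≡ᵇ⇒≡ _ _ (proj₁ (Equivalence.to T-∧ isDyck)) ⟩
      n
    ∎))

2*≡twice : ∀ n → 2 * n ≡ twice n
2*≡twice zero    = refl
2*≡twice (suc n) = cong suc (trans (+-suc n (n + 0)) (cong suc (2*≡twice n)))

mainTheorem8 : (n : ℕ) → n ≥ 1 →
    countDyckKT-12 2 0 n 1 (n ∸ 1) ≡ totalValleys n
mainTheorem8 n _ = begin
    countDyckKT-12 2 0 n 1 (n ∸ 1)
  ≡⟨ length-filterᵇ _ (allPaths (3 * n)) ⟩
    Σpaths (3 * n) _
  ≡⟨ Σpaths-cong (3 * n) (oneOddDown-indicator n) ⟩
    ΣpathsFrom 2 (3 * n) 0 n (2 * n) (λ p → if downsAtMod 2 1 (+ 0) p ≡ᵇ 1 then 1 else 0)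
  ≡⟨ ΣpathsFrom-downsAt 2 1 1 (3 * n) 0 n (2 * n) refl ⟩
    pathCountDownsAt 2 1 1 0 n (2 * n)
  ≡⟨ cong (pathCountDownsAt 2 1 1 0 n) (2*≡twice n) ⟩
    pathCountDownsAt 2 1 1 (twice 0) n (twice n)
  ≡⟨ oneOddDown≡valleyCount 0 n n ⟩
    valleyCount 1 0 n n
  ≡⟨ cong (valleyCount 1 0 n) (*-identityˡ n) ⟨
    valleyCount 1 0 n (1 * n)
  ≡⟨ ΣpathsFrom-valleys 1 (2 * n) 0 n (1 * n) refl ⟨
    ΣpathsFrom 1 (2 * n) 0 n (1 * n) valleys
  ≡⟨ Σpaths-cong (2 * n) (λ p → if-cong (counts∧staysEnds≡isPathFrom 1 0 n (1 * n) p)) ⟨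
    Σpaths (2 * n) (λ p → if isDyck n p then valleys p else 0)
  ≡⟨ sum-map-filterᵇ (isDyck n) valleys (allPaths (2 * n)) ⟨
    totalValleys n
  ∎
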